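{- Let $k\le n$ be positive integers, $d\ge 0$ an integer, and $\mathcal{I}=(p_1,\ldots,p_k)$ a $k$-tuple of invariant factors over $\mathbb{F}_q$ with $\deg\mathcal{I}\le kd$. Then $$\mu_q(n,k,d;(p_1,\ldots,p_k))=\mu_q(n,k,d-d_1;(\tilde p_1,\ldots,\tilde p_k)),$$ where $d_1=\deg p_1$ and $\tilde p_i=p_i/p_1$ for $1\le i\le k$.
   Context: A $k$-tuple of invariant factors is $(f_1,\ldots,f_k)$ with each $f_i$ monic in $\mathbb{F}_q[x]$ and $f_i\mid f_{i+1}$; its degree is $\deg(f_1\cdots f_k)$. For positive integers $k\le n$ and integer $d\ge 0$, $M_q(n,k,d)$ is the set of $n\times k$ matrices over $\mathbb{F}_q[x]$ of the form $x^dI+x^{d-1}C_{d-1}+\cdots+C_0$ with $C_i\in M_{n,k}(\mathbb{F}_q)$, where $I$ is the $n\times k$ matrix with $(i,j)$ entry $1$ if $i=j$ and $0$ otherwise (so $M_q(n,k,0)=\{I\}$). Each $P\in M_q(n,k,d)$ is equivalent (i.e. $APB$ for invertible $A\in M_n(\mathbb{F}_q[x])$, $B\in M_k(\mathbb{F}_q[x])$) to a unique $\mathrm{diag}_{n,k}(p_1,\ldots,p_k)$ with $(p_1,\ldots,p_k)$ a $k$-tuple of invariant factors (its Smith normal form); these are the invariant factors of $P$. $\mu_q(n,k,d;\mathcal{I})$ is the number of $P\in M_q(n,k,d)$ with invariant factors $\mathcal{I}$. Throughout, $\mu_q(n,k,d;\mathcal{I})$ is only considered when $\deg\mathcal{I}\le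 kd$. -}

module Defs where

open import Level using (0ℓ)
open import Data.Nat using (ℕ; zero; suc)
import Data.Nat
import Data.Fin
import Data.Unit
import Data.List
import Relation.Nullary
open import Data.Fin using (Fin; toℕ)
open import Data.Vec using (Vec; []; _∷_; lookup; toList; map)
open import Data.List using (List; []; _∷_; _++_; [_])
open import Data.Product using (Σ; _×_; _,_)
open import Relation.Nullary using (¬_)
open import Relation.Binary.PropositionalEquality using (_≡_)
open import Relation.Binary.Definitions using (DecidableEquality)
open import Function.Bundles using (_↔_)
import Algebra.Structures as AS

-- A finite field F_q (q = size), with propositional equality as the
-- ring equality.
record FiniteField : Set₁ where
  field
    Carrier : Set
    _+_ _*_ : Carrier → Carrier → Carrier
    -_      : Carrier → Carrier
    0# 1#   : Carrier
    isCommutativeRing : AS.IsCommutativeRing (_≡_ {A = Carrier}) _+_ _*_ -_ 0# 1#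
    _≟_     : DecidableEquality Carrier
    0≢1     : ¬ (0# ≡ 1#)
    inverse : ∀ x → ¬ (x ≡ 0#) → Σ Carrier (λ y → x * y ≡ 1#)
    size    : ℕ
    enum    : Carrier ↔ Fin size

module FF (F : FiniteField) where
  open FiniteField F

  -- Polynomials in F[x] as coefficient lists (constant term first).
  Poly : Set
  Poly = List Carrier

  coeff : Poly → ℕ → Carrier
  coeff []      _       = 0#
  coeff (a ∷ p) zero    = a
  coeff (a ∷ p) (suc i) = coeff p i

  -- equality of polynomials: equal coefficients (trailing zeros irrelevant)
  _≈ₚ_ : Poly → Poly → Set
  p ≈ₚ q = ∀ i → coeff p i ≡ coeff q i

  _+ₚ_ : Poly → Poly → Poly
  []      +ₚ q       = q
  (a ∷ p) +ₚ []      = a ∷ p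
  (a ∷ p) +ₚ (b ∷ q) = (a + b) ∷ (p +ₚ q)

  _*ₚ_ : Poly → Poly → Poly
  []      *ₚ q = []
  (a ∷ p) *ₚ q = Data.List.map (a *_) q +ₚ (0# ∷ (p *ₚ q))

  _∣ₚ_ : Poly → Poly → Set
  f ∣ₚ g = Σ Poly (λ h → (f *ₚ h) ≈ₚ g)

  -- monic polynomial of degree deg: x^deg + (lower coefficients)
  record Monic : Set where
    constructor monic
    field
      deg : ℕ
      low : Vec Carrier deg

  toPoly : Monic → Poly
  toPoly (monic _ low) = toList low ++ [ 1# ]

  DivChain : ∀ {k} → Vec Monic k → Set
  DivChain []           = Data.Unit.⊤
  DivChain (p ∷ [])     = Data.Unit.⊤
  DivChain (p ∷ q ∷ ps) = (toPoly p ∣ₚ toPoly q) × DivChain (q ∷ ps)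

  -- k-tuples of invariant factors (monicity built into Monic)
  IsInvariantFactors : ∀ {k} → Vec Monic k → Set
  IsInvariantFactors = DivChain

  degT : ∀ {k} → Vec Monic k → ℕ
  degT []       = 0
  degT (p ∷ ps) = Monic.deg p Data.Nat.+ degT ps

  PMat : ℕ → ℕ → Set
  PMat m l = Fin m → Fin l → Poly

  _≈ₘ_ : ∀ {m l} → PMat m l → PMat m l → Set
  A ≈ₘ B = ∀ i j → A i j ≈ₚ B i j

  sumFin : ∀ {m} → (Fin m → Poly) → Poly
  sumFin {zero}  f = []
  sumFin {suc m} f = f Data.Fin.zero +ₚ sumFin (λ i → f (Data.Fin.suc i))

  mul : ∀ {m l r} → PMat m l → PMat l r → PMat m r
  mul A B i j = sumFin (λ t → A i t *ₚ B t j)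

  diagWith : ∀ {m l} → (Fin l → Poly) → PMat m l
  diagWith {m} {l} f i j with toℕ i Data.Nat.≟ toℕ j
  ... | Relation.Nullary.yes _ = f j
  ... | Relation.Nullary.no  _ = []

  Id : ∀ {m l} → PMat m l
  Id = diagWith (λ _ → [ 1# ])

  diagₘ : ∀ {n k} → Vec Monic k → PMat n k
  diagₘ ps = diagWith (λ j → toPoly (lookup ps j))

  Invertible : ∀ {m} → PMat m m → Set
  Invertible {m} A = Σ (PMat m m) (λ A' → (mul A A' ≈ₘ Id) × (mul A' A ≈ₘ Id))

  Equivalent : ∀ {n k} → PMat n k → PMat n k → Set
  Equivalent {n} {k} P Q =
    Σ (PMat n n) (λ A → Σ (PMat k k) (λ B →
      Invertible A × Invertible B × (mul (mul A P) B ≈ₘ Q)))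

  CMat : ℕ → ℕ → Set
  CMat n k = Vec (Vec Carrier k) n

  -- an element of M_q(n,k,d) is given by (C_0, …, C_{d-1});
  -- the matrix is x^d I + x^{d-1} C_{d-1} + … + C_0
  toPMat : ∀ {n k d} → Vec (CMat n k) d → PMat n k
  toPMat Cs i j = toList (map (λ C → lookup (lookup C i) j) Cs) ++ [ δ ]
    where
      δ : Carrier
      δ with toℕ i Data.Nat.≟ toℕ j
      ... | Relation.Nullary.yes _ = 1#
      ... | Relation.Nullary.no  _ = 0#

  record ∥_∥ (A : Set) : Set where
    constructor ∣_∣
    field
      .proof : A

  -- { P ∈ M_q(n,k,d) | P has invariant factors I }, whose cardinality
  -- is μ_q(n,k,d;I)
  record MSet (n k d : ℕ) (I : Vec Monic k) : Set where
    constructor mk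
    field
      coeffs : Vec (CMat n k) d
      hasIF  : ∥ Equivalent (toPMat coeffs) (diagₘ {n} I) ∥

{-# OPTIONS --safe #-}
-- If P is equivalent to D = diag(p₁,…,p_k) = p₁ · diag(p̃₁,…,p̃_k), then P = A⁻¹ D B⁻¹ has every
-- entry divisible by p₁. As p₁ is monic of degree d₁, dividing entrywise by p₁ turns
-- x^d I + lower terms into x^(d−d₁) I + lower terms, keeps the transforming matrices A, B, and is
-- undone by multiplication with p₁, which cancels since it is not a zero divisor; so it is a
-- bijection onto the matrices with invariant factors p̃ᵢ. The degree bound gives d₁ ≤ d, since
-- every pᵢ is a multiple of p₁ and so has degree at least d₁.
module Submission where

open import Level using (0ℓ)
open import Data.Nat as ℕ using (ℕ; zero; suc; _+_; _≤_; _<_; z≤n; s≤s; _*_; _∸_)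
import Data.Nat.Properties as ℕₚ
open import Data.Fin as Fin using (Fin; toℕ)
open import Data.List using ([]; _∷_; _++_; [_]; map; length)
open import Data.Vec as Vec using (Vec; []; _∷_; lookup; head; toList)
import Data.Vec.Properties as Vecₚ
import Data.Fin.Properties as Finₚ
open import Relation.Binary.Definitions using (Tri; tri<; tri≈; tri>; DecidableEquality)
open import Relation.Nullary.Decidable using (recompute)
open import Data.Product using (Σ; _,_)
open import Data.Sum using (_⊎_; inj₁; inj₂)
open import Relation.Nullary using (¬_; yes; no; contradiction)
open import Function.Bundles using (_↔_; mk↔ₛ′)
open import Relation.Binary.Bundles using (Setoid)
open import Relation.Binary.PropositionalEquality
  using (_≡_; _≢_; refl; sym; trans; cong; cong₂; subst; module ≡-Reasoning)
open import Algebra.Bundles using (AbelianGroup; CommutativeRing)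
import Algebra.Structures as AS
import Algebra.Properties.Ring as RingProperties
import Algebra.Properties.CommutativeSemigroup as CommutativeSemigroupProperties
import Algebra.Properties.Group as GroupProperties
import Algebra.Properties.AbelianGroup as AbelianGroupProperties
import Relation.Binary.Reasoning.Setoid

open import Defs

module Polynomial (F : FiniteField) where
  open FiniteField F using (Carrier; 0#; 1#; isCommutativeRing)
  open FF F

  infixl 6 _+ᶠ_
  infixl 7 _*ᶠ_
  infix  8 -ᶠ_
  _+ᶠ_ _*ᶠ_ : Carrier → Carrier → Carrier
  _+ᶠ_ = FiniteField._+_ F
  _*ᶠ_ = FiniteField._*_ F
  -ᶠ_ : Carrier → Carrier
  -ᶠ_ = FiniteField.-_ F

  coefficientRing : CommutativeRing 0ℓ 0ℓ
  coefficientRing = record { isCommutativeRing = isCommutativeRing }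

  module 𝔽 where
    open CommutativeRing coefficientRing public
    open RingProperties ring public using (-0#≈0#)

  infix 4 _≋_
  -- A record wrapper around _≈ₚ_, so that both polynomials are inferable.
  record _≋_ (p q : Poly) : Set where
    constructor coeffwise
    field coeff-≡ : ∀ i → coeff p i ≡ coeff q i
  open _≋_ public

  ≋-refl : ∀ {p} → p ≋ p
  ≋-refl = coeffwise λ _ → refl

  ≋-reflexive : ∀ {p q} → p ≡ q → p ≋ q
  ≋-reflexive refl = ≋-refl

  ≋-sym : ∀ {p q} → p ≋ q → q ≋ p
  ≋-sym (coeffwise e) = coeffwise λ i → sym (e i)

  ≋-trans : ∀ {p q r} → p ≋ q → q ≋ r → p ≋ r
  ≋-trans (coeffwise e) (coeffwise f) = coeffwise λ i → trans (e i) (f i)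

  ≋-setoid : Setoid 0ℓ 0ℓ
  ≋-setoid = record
    { Carrier = Poly ; _≈_ = _≋_
    ; isEquivalence = record { refl = ≋-refl ; sym = ≋-sym ; trans = ≋-trans } }

  module ≋-Reasoning = Relation.Binary.Reasoning.Setoid ≋-setoid

  -ₚ_ : Poly → Poly
  -ₚ_ = map -ᶠ_

  _·ₚ_ : Carrier → Poly → Poly
  a ·ₚ p = map (a *ᶠ_) p

  coeff-+ₚ : ∀ p q i → coeff (p +ₚ q) i ≡ coeff p i +ᶠ coeff q i
  coeff-+ₚ []      q       i       = sym (𝔽.+-identityˡ _)
  coeff-+ₚ (a ∷ p) []      i       = sym (𝔽.+-identityʳ _)
  coeff-+ₚ (a ∷ p) (b ∷ q) zero    = refl
  coeff-+ₚ (a ∷ p) (b ∷ q) (suc i) = coeff-+ₚ p q i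

  coeff-map : ∀ f → f 0# ≡ 0# → ∀ p i → coeff (map f p) i ≡ f (coeff p i)
  coeff-map f f0≡0 []      i       = sym f0≡0
  coeff-map f f0≡0 (a ∷ p) zero    = refl
  coeff-map f f0≡0 (a ∷ p) (suc i) = coeff-map f f0≡0 p i

  coeff-·ₚ : ∀ a p i → coeff (a ·ₚ p) i ≡ a *ᶠ coeff p i
  coeff-·ₚ a = coeff-map (a *ᶠ_) (𝔽.zeroʳ a)

  coeff--ₚ : ∀ p i → coeff (-ₚ p) i ≡ -ᶠ coeff p i
  coeff--ₚ = coeff-map -ᶠ_ 𝔽.-0#≈0#

  ∷-cong : ∀ {a b p q} → a ≡ b → p ≋ q → (a ∷ p) ≋ (b ∷ q)
  ∷-cong a≡b (coeffwise e) = coeffwise λ { zero → a≡b ; (suc i) → e i }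

  +ₚ-cong : ∀ {p p′ q q′} → p ≋ p′ → q ≋ q′ → (p +ₚ q) ≋ (p′ +ₚ q′)
  +ₚ-cong {p} {p′} {q} {q′} (coeffwise e) (coeffwise f) = coeffwise λ i → begin
    coeff (p +ₚ q) i           ≡⟨ coeff-+ₚ p q i ⟩
    coeff p i +ᶠ coeff q i     ≡⟨ cong₂ _+ᶠ_ (e i) (f i) ⟩
    coeff p′ i +ᶠ coeff q′ i   ≡⟨ coeff-+ₚ p′ q′ i ⟨
    coeff (p′ +ₚ q′) i         ∎
    where open ≡-Reasoning

  +ₚ-comm : ∀ p q → (p +ₚ q) ≋ (q +ₚ p)
  +ₚ-comm p q = coeffwise λ i → begin
    coeff (p +ₚ q) i         ≡⟨ coeff-+ₚ p q i ⟩
    coeff p i +ᶠ coeff q i   ≡⟨ 𝔽.+-comm _ _ ⟩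
    coeff q i +ᶠ coeff p i   ≡⟨ coeff-+ₚ q p i ⟨
    coeff (q +ₚ p) i         ∎
    where open ≡-Reasoning

  +ₚ-assoc : ∀ p q r → ((p +ₚ q) +ₚ r) ≋ (p +ₚ (q +ₚ r))
  +ₚ-assoc p q r = coeffwise λ i → begin
    coeff ((p +ₚ q) +ₚ r) i                     ≡⟨ coeff-+ₚ (p +ₚ q) r i ⟩
    coeff (p +ₚ q) i +ᶠ coeff r i               ≡⟨ cong (_+ᶠ coeff r i) (coeff-+ₚ p q i) ⟩
    (coeff p i +ᶠ coeff q i) +ᶠ coeff r i       ≡⟨ 𝔽.+-assoc _ _ _ ⟩
    coeff p i +ᶠ (coeff q i +ᶠ coeff r i)       ≡⟨ cong (coeff p i +ᶠ_) (coeff-+ₚ q r i) ⟨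
    coeff p i +ᶠ coeff (q +ₚ r) i               ≡⟨ coeff-+ₚ p (q +ₚ r) i ⟨
    coeff (p +ₚ (q +ₚ r)) i                     ∎
    where open ≡-Reasoning

  +ₚ-identityˡ : ∀ p → ([] +ₚ p) ≋ p
  +ₚ-identityˡ p = ≋-refl

  +ₚ-identityʳ : ∀ p → (p +ₚ []) ≋ p
  +ₚ-identityʳ p = coeffwise λ i → trans (coeff-+ₚ p [] i) (𝔽.+-identityʳ _)

  -ₚ-inverseˡ : ∀ p → ((-ₚ p) +ₚ p) ≋ []
  -ₚ-inverseˡ p = coeffwise λ i → begin
    coeff ((-ₚ p) +ₚ p) i           ≡⟨ coeff-+ₚ (-ₚ p) p i ⟩
    coeff (-ₚ p) i +ᶠ coeff p i     ≡⟨ cong (_+ᶠ coeff p i) (coeff--ₚ p i) ⟩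
    -ᶠ coeff p i +ᶠ coeff p i       ≡⟨ 𝔽.-‿inverseˡ _ ⟩
    0#                              ∎
    where open ≡-Reasoning

  -ₚ-inverseʳ : ∀ p → (p +ₚ (-ₚ p)) ≋ []
  -ₚ-inverseʳ p = ≋-trans (+ₚ-comm p (-ₚ p)) (-ₚ-inverseˡ p)

  -ₚ-cong : ∀ {p q} → p ≋ q → (-ₚ p) ≋ (-ₚ q)
  -ₚ-cong {p} {q} (coeffwise e) = coeffwise λ i →
    trans (coeff--ₚ p i) (trans (cong -ᶠ_ (e i)) (sym (coeff--ₚ q i)))

  +ₚ-isAbelianGroup : AS.IsAbelianGroup _≋_ _+ₚ_ [] -ₚ_
  +ₚ-isAbelianGroup = record
    { isGroup = record
      { isMonoid = record
        { isSemigroup = record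
          { isMagma = record
            { isEquivalence = Setoid.isEquivalence ≋-setoid
            ; ∙-cong = +ₚ-cong }
          ; assoc = +ₚ-assoc }
        ; identity = +ₚ-identityˡ , +ₚ-identityʳ }
      ; inverse = -ₚ-inverseˡ , -ₚ-inverseʳ
      ; ⁻¹-cong = -ₚ-cong }
    ; comm = +ₚ-comm }

  +ₚ-abelianGroup : AbelianGroup 0ℓ 0ℓ
  +ₚ-abelianGroup = record { isAbelianGroup = +ₚ-isAbelianGroup }

  module +ₚ = CommutativeSemigroupProperties (AbelianGroup.commutativeSemigroup +ₚ-abelianGroup)

  ·ₚ-cong : ∀ a {p q} → p ≋ q → (a ·ₚ p) ≋ (a ·ₚ q)
  ·ₚ-cong a {p} {q} (coeffwise e) = coeffwise λ i →
    trans (coeff-·ₚ a p i) (trans (cong (a *ᶠ_) (e i)) (sym (coeff-·ₚ a q i)))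

  ·ₚ-distrib-+ₚ : ∀ a p q → (a ·ₚ (p +ₚ q)) ≋ ((a ·ₚ p) +ₚ (a ·ₚ q))
  ·ₚ-distrib-+ₚ a p q = coeffwise λ i → begin
    coeff (a ·ₚ (p +ₚ q)) i                        ≡⟨ coeff-·ₚ a (p +ₚ q) i ⟩
    a *ᶠ coeff (p +ₚ q) i                          ≡⟨ cong (a *ᶠ_) (coeff-+ₚ p q i) ⟩
    a *ᶠ (coeff p i +ᶠ coeff q i)                  ≡⟨ 𝔽.distribˡ a _ _ ⟩
    a *ᶠ coeff p i +ᶠ a *ᶠ coeff q i               ≡⟨ cong₂ _+ᶠ_ (coeff-·ₚ a p i) (coeff-·ₚ a q i) ⟨
    coeff (a ·ₚ p) i +ᶠ coeff (a ·ₚ q) i           ≡⟨ coeff-+ₚ (a ·ₚ p) (a ·ₚ q) i ⟨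
    coeff ((a ·ₚ p) +ₚ (a ·ₚ q)) i                 ∎
    where open ≡-Reasoning

  0·ₚ : ∀ p → (0# ·ₚ p) ≋ []
  0·ₚ p = coeffwise λ i → trans (coeff-·ₚ 0# p i) (𝔽.zeroˡ _)

  ·ₚ-·ₚ : ∀ a b p → (a ·ₚ (b ·ₚ p)) ≋ ((a *ᶠ b) ·ₚ p)
  ·ₚ-·ₚ a b p = coeffwise λ i → begin
    coeff (a ·ₚ (b ·ₚ p)) i     ≡⟨ coeff-·ₚ a (b ·ₚ p) i ⟩
    a *ᶠ coeff (b ·ₚ p) i       ≡⟨ cong (a *ᶠ_) (coeff-·ₚ b p i) ⟩
    a *ᶠ (b *ᶠ coeff p i)       ≡⟨ 𝔽.*-assoc a b _ ⟨
    (a *ᶠ b) *ᶠ coeff p i       ≡⟨ coeff-·ₚ (a *ᶠ b) p i ⟨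
    coeff ((a *ᶠ b) ·ₚ p) i     ∎
    where open ≡-Reasoning

  1·ₚ : ∀ p → (1# ·ₚ p) ≋ p
  1·ₚ p = coeffwise λ i → trans (coeff-·ₚ 1# p i) (𝔽.*-identityˡ _)

  0∷-+ₚ : ∀ p q → (0# ∷ (p +ₚ q)) ≋ ((0# ∷ p) +ₚ (0# ∷ q))
  0∷-+ₚ p q = ∷-cong (sym (𝔽.+-identityˡ 0#)) ≋-refl

  *ₚ-congʳ : ∀ p {q q′} → q ≋ q′ → (p *ₚ q) ≋ (p *ₚ q′)
  *ₚ-congʳ []      q≋q′ = ≋-refl
  *ₚ-congʳ (a ∷ p) q≋q′ = +ₚ-cong (·ₚ-cong a q≋q′) (∷-cong refl (*ₚ-congʳ p q≋q′))

  *ₚ-zeroʳ : ∀ p → (p *ₚ []) ≋ []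
  *ₚ-zeroʳ []      = ≋-refl
  *ₚ-zeroʳ (a ∷ p) = coeffwise λ { zero → refl ; (suc i) → coeff-≡ (*ₚ-zeroʳ p) i }

  *ₚ-∷ʳ : ∀ p b q → (p *ₚ (b ∷ q)) ≋ ((b ·ₚ p) +ₚ (0# ∷ (p *ₚ q)))
  *ₚ-∷ʳ []      b q = coeffwise λ { zero → refl ; (suc i) → refl }
  *ₚ-∷ʳ (a ∷ p) b q = ∷-cong (cong (_+ᶠ _) (𝔽.*-comm a b)) (begin
    (a ·ₚ q) +ₚ (p *ₚ (b ∷ q))                      ≈⟨ +ₚ-cong ≋-refl (*ₚ-∷ʳ p b q) ⟩
    (a ·ₚ q) +ₚ ((b ·ₚ p) +ₚ (0# ∷ (p *ₚ q)))       ≈⟨ +ₚ.x∙yz≈y∙xz (a ·ₚ q) (b ·ₚ p) _ ⟩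
    (b ·ₚ p) +ₚ ((a ·ₚ q) +ₚ (0# ∷ (p *ₚ q)))       ∎)
    where open ≋-Reasoning

  *ₚ-comm : ∀ p q → (p *ₚ q) ≋ (q *ₚ p)
  *ₚ-comm []      q = ≋-sym (*ₚ-zeroʳ q)
  *ₚ-comm (a ∷ p) q =
    ≋-trans (+ₚ-cong ≋-refl (∷-cong refl (*ₚ-comm p q))) (≋-sym (*ₚ-∷ʳ q a p))

  *ₚ-congˡ : ∀ {p p′} q → p ≋ p′ → (p *ₚ q) ≋ (p′ *ₚ q)
  *ₚ-congˡ {p} {p′} q p≋p′ = ≋-trans (*ₚ-comm p q) (≋-trans (*ₚ-congʳ q p≋p′) (*ₚ-comm q p′))

  *ₚ-cong : ∀ {p p′ q q′} → p ≋ p′ → q ≋ q′ → (p *ₚ q) ≋ (p′ *ₚ q′)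
  *ₚ-cong {p′ = p′} {q = q} p≋p′ q≋q′ = ≋-trans (*ₚ-congˡ q p≋p′) (*ₚ-congʳ p′ q≋q′)

  *ₚ-distribˡ-+ₚ : ∀ p q r → (p *ₚ (q +ₚ r)) ≋ ((p *ₚ q) +ₚ (p *ₚ r))
  *ₚ-distribˡ-+ₚ []      q r = ≋-refl
  *ₚ-distribˡ-+ₚ (a ∷ p) q r = begin
    (a ·ₚ (q +ₚ r)) +ₚ (0# ∷ (p *ₚ (q +ₚ r)))
      ≈⟨ +ₚ-cong (·ₚ-distrib-+ₚ a q r)
                 (≋-trans (∷-cong refl (*ₚ-distribˡ-+ₚ p q r)) (0∷-+ₚ (p *ₚ q) (p *ₚ r))) ⟩
    ((a ·ₚ q) +ₚ (a ·ₚ r)) +ₚ ((0# ∷ (p *ₚ q)) +ₚ (0# ∷ (p *ₚ r)))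
      ≈⟨ +ₚ.interchange (a ·ₚ q) (a ·ₚ r) _ _ ⟩
    ((a ·ₚ q) +ₚ (0# ∷ (p *ₚ q))) +ₚ ((a ·ₚ r) +ₚ (0# ∷ (p *ₚ r)))
      ∎
    where open ≋-Reasoning

  *ₚ-distribʳ-+ₚ : ∀ p q r → ((q +ₚ r) *ₚ p) ≋ ((q *ₚ p) +ₚ (r *ₚ p))
  *ₚ-distribʳ-+ₚ p q r = begin
    (q +ₚ r) *ₚ p             ≈⟨ *ₚ-comm (q +ₚ r) p ⟩
    p *ₚ (q +ₚ r)             ≈⟨ *ₚ-distribˡ-+ₚ p q r ⟩
    (p *ₚ q) +ₚ (p *ₚ r)      ≈⟨ +ₚ-cong (*ₚ-comm p q) (*ₚ-comm p r) ⟩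
    (q *ₚ p) +ₚ (r *ₚ p)      ∎
    where open ≋-Reasoning

  ·ₚ-*ₚ : ∀ a q r → ((a ·ₚ q) *ₚ r) ≋ (a ·ₚ (q *ₚ r))
  ·ₚ-*ₚ a []      r = ≋-refl
  ·ₚ-*ₚ a (b ∷ q) r = begin
    ((a *ᶠ b) ·ₚ r) +ₚ (0# ∷ ((a ·ₚ q) *ₚ r))
      ≈⟨ +ₚ-cong (≋-sym (·ₚ-·ₚ a b r)) (∷-cong (sym (𝔽.zeroʳ a)) (·ₚ-*ₚ a q r)) ⟩
    (a ·ₚ (b ·ₚ r)) +ₚ (a ·ₚ (0# ∷ (q *ₚ r)))
      ≈⟨ ·ₚ-distrib-+ₚ a (b ·ₚ r) _ ⟨
    a ·ₚ ((b ·ₚ r) +ₚ (0# ∷ (q *ₚ r)))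
      ∎
    where open ≋-Reasoning

  0∷-*ₚ : ∀ p r → ((0# ∷ p) *ₚ r) ≋ (0# ∷ (p *ₚ r))
  0∷-*ₚ p r = +ₚ-cong (0·ₚ r) ≋-refl

  *ₚ-assoc : ∀ p q r → ((p *ₚ q) *ₚ r) ≋ (p *ₚ (q *ₚ r))
  *ₚ-assoc []      q r = ≋-refl
  *ₚ-assoc (a ∷ p) q r = begin
    ((a ·ₚ q) +ₚ (0# ∷ (p *ₚ q))) *ₚ r
      ≈⟨ *ₚ-distribʳ-+ₚ r (a ·ₚ q) (0# ∷ (p *ₚ q)) ⟩
    ((a ·ₚ q) *ₚ r) +ₚ ((0# ∷ (p *ₚ q)) *ₚ r)
      ≈⟨ +ₚ-cong (·ₚ-*ₚ a q r) (≋-trans (0∷-*ₚ (p *ₚ q) r) (∷-cong refl (*ₚ-assoc p q r))) ⟩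
    (a ·ₚ (q *ₚ r)) +ₚ (0# ∷ (p *ₚ (q *ₚ r)))
      ∎
    where open ≋-Reasoning

  [_]-*ₚ : ∀ a p → ([ a ] *ₚ p) ≋ (a ·ₚ p)
  [ a ]-*ₚ p = ≋-trans (+ₚ-cong {p = a ·ₚ p} ≋-refl 0∷[]≋[]) (+ₚ-identityʳ (a ·ₚ p))
    where
    0∷[]≋[] : (0# ∷ []) ≋ []
    0∷[]≋[] = coeffwise λ { zero → refl ; (suc i) → refl }

  *ₚ-0∷ : ∀ p q → (p *ₚ (0# ∷ q)) ≋ (0# ∷ (p *ₚ q))
  *ₚ-0∷ p q = begin
    p *ₚ (0# ∷ q)     ≈⟨ *ₚ-comm p (0# ∷ q) ⟩
    (0# ∷ q) *ₚ p     ≈⟨ 0∷-*ₚ q p ⟩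
    0# ∷ (q *ₚ p)     ≈⟨ ∷-cong refl (*ₚ-comm q p) ⟩
    0# ∷ (p *ₚ q)     ∎
    where open ≋-Reasoning

  *ₚ-identityˡ : ∀ p → ([ 1# ] *ₚ p) ≋ p
  *ₚ-identityˡ p = ≋-trans ([ 1# ]-*ₚ p) (1·ₚ p)

  *ₚ-identityʳ : ∀ p → (p *ₚ [ 1# ]) ≋ p
  *ₚ-identityʳ p = ≋-trans (*ₚ-comm p [ 1# ]) (*ₚ-identityˡ p)

  polynomialRing : CommutativeRing 0ℓ 0ℓ
  polynomialRing = record
    { isCommutativeRing = record
      { isRing = record
        { +-isAbelianGroup = +ₚ-isAbelianGroup
        ; *-cong = *ₚ-cong
        ; *-assoc = *ₚ-assoc
        ; *-identity = *ₚ-identityˡ , *ₚ-identityʳ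
        ; distrib = *ₚ-distribˡ-+ₚ , *ₚ-distribʳ-+ₚ }
      ; *-comm = *ₚ-comm } }

module MonicPolynomial (F : FiniteField) where
  open FiniteField F using (Carrier; 0#; 1#; 0≢1)
  open FF F
  open Monic
  open Polynomial F

  private
    module ℙ where
      open CommutativeRing polynomialRing using (ring; +-group; +-abelianGroup)
      open RingProperties ring public using (x[y-z]≈xy-xz)
      open GroupProperties +-group public using (x∙y⁻¹≈ε⇒x≈y)
      open AbelianGroupProperties +-abelianGroup public using (xyx⁻¹≈y)

  infix 4 _deg<_
  _deg<_ : Poly → ℕ → Set
  p deg< t = ∀ j → t ≤ j → coeff p j ≡ 0#

  deg<-cong : ∀ {p q t} → p ≋ q → q deg< t → p deg< t
  deg<-cong (coeffwise e) q<t j t≤j = trans (e j) (q<t j t≤j)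

  deg<-weaken : ∀ {p t t′} → t ≤ t′ → p deg< t → p deg< t′
  deg<-weaken t≤t′ p<t j t′≤j = p<t j (ℕₚ.≤-trans t≤t′ t′≤j)

  deg<0⇒≋[] : ∀ {p} → p deg< 0 → p ≋ []
  deg<0⇒≋[] p<0 = coeffwise λ j → p<0 j z≤n

  deg<-length : ∀ p → p deg< length p
  deg<-length []      j       _         = refl
  deg<-length (a ∷ p) (suc j) (s≤s l≤j) = deg<-length p j l≤j

  -- Descending induction on the degree bound, starting from the length.
  deg<-lower : ∀ {p t} → (∀ s → t ≤ s → p deg< suc s → coeff p s ≡ 0#) → p deg< t
  deg<-lower {p} {t} top≡0 = descend (length p) λ j le →
    deg<-length p j (ℕₚ.≤-trans (ℕₚ.m≤n+m (length p) t) le)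
    where
    descend : ∀ r → p deg< (t + r) → p deg< t
    descend zero    p<t+0 = subst (p deg<_) (ℕₚ.+-identityʳ t) p<t+0
    descend (suc r) p<t+r+1 = descend r p<t+r
      where
      p<suc[t+r] : p deg< suc (t + r)
      p<suc[t+r] = subst (p deg<_) (ℕₚ.+-suc t r) p<t+r+1
      p<t+r : p deg< (t + r)
      p<t+r j le with ℕₚ.m≤n⇒m<n∨m≡n le
      ... | inj₁ t+r<j = p<suc[t+r] j t+r<j
      ... | inj₂ refl  = top≡0 (t + r) (ℕₚ.m≤m+n t r) p<suc[t+r]

  coeff-toList++-lookup : ∀ {d} (v : Vec Carrier d) x (i : Fin d) →
                          coeff (toList v ++ [ x ]) (toℕ i) ≡ lookup v i
  coeff-toList++-lookup (a ∷ v) x Fin.zero    = refl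
  coeff-toList++-lookup (a ∷ v) x (Fin.suc i) = coeff-toList++-lookup v x i

  coeff-toList++-last : ∀ {d} (v : Vec Carrier d) x → coeff (toList v ++ [ x ]) d ≡ x
  coeff-toList++-last []      x = refl
  coeff-toList++-last (a ∷ v) x = coeff-toList++-last v x

  toList++-deg< : ∀ {d} (v : Vec Carrier d) x → (toList v ++ [ x ]) deg< suc d
  toList++-deg< []      x (suc j) _        = refl
  toList++-deg< (a ∷ v) x (suc j) (s≤s le) = toList++-deg< v x j le

  *ₚ-monic-coeff : ∀ m {h u} → h deg< suc u → coeff (toPoly m *ₚ h) (deg m + u) ≡ coeff h u
  *ₚ-monic-coeff (monic zero [])           {h} {u} _ = coeff-≡ (*ₚ-identityˡ h) u
  *ₚ-monic-coeff (monic (suc d) (c ∷ low)) {h} {u} h<u+1 = begin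
    coeff ((c ·ₚ h) +ₚ (0# ∷ (toPoly (monic d low) *ₚ h))) (suc (d + u))
      ≡⟨ coeff-+ₚ (c ·ₚ h) _ (suc (d + u)) ⟩
    coeff (c ·ₚ h) (suc (d + u)) +ᶠ coeff (toPoly (monic d low) *ₚ h) (d + u)
      ≡⟨ cong₂ _+ᶠ_ (trans (coeff-·ₚ c h _) (cong (c *ᶠ_) (h<u+1 _ (s≤s (ℕₚ.m≤n+m u d)))))
                    (*ₚ-monic-coeff (monic d low) {h} h<u+1) ⟩
    c *ᶠ 0# +ᶠ coeff h u
      ≡⟨ cong (_+ᶠ coeff h u) (𝔽.zeroʳ c) ⟩
    0# +ᶠ coeff h u
      ≡⟨ 𝔽.+-identityˡ _ ⟩
    coeff h u ∎
    where
    open ≡-Reasoning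

  *ₚ-monic-deg< : ∀ m {h t} → h deg< t → (toPoly m *ₚ h) deg< (deg m + t)
  *ₚ-monic-deg< m {h} {t} h<t j m+t≤j = begin
    coeff (toPoly m *ₚ h) j
      ≡⟨ cong (coeff (toPoly m *ₚ h)) (ℕₚ.m+[n∸m]≡n m≤j) ⟨
    coeff (toPoly m *ₚ h) (deg m + (j ∸ deg m))
      ≡⟨ *ₚ-monic-coeff m (deg<-weaken {h} (ℕₚ.m≤n⇒m≤1+n t≤j∸m) h<t) ⟩
    coeff h (j ∸ deg m)
      ≡⟨ h<t (j ∸ deg m) t≤j∸m ⟩
    0# ∎
    where
    open ≡-Reasoning
    m≤j : deg m ≤ j
    m≤j = ℕₚ.m+n≤o⇒m≤o (deg m) m+t≤j
    t≤j∸m : t ≤ j ∸ deg m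
    t≤j∸m = ℕₚ.m+n≤o⇒m≤o∸n t (subst (_≤ j) (ℕₚ.+-comm (deg m) t) m+t≤j)

  *ₚ-monic-deg<⁻¹ : ∀ m {h t} → (toPoly m *ₚ h) deg< (deg m + t) → h deg< t
  *ₚ-monic-deg<⁻¹ m {h} mh<m+t = deg<-lower {h} λ s t≤s h<s+1 →
    trans (sym (*ₚ-monic-coeff m h<s+1)) (mh<m+t (deg m + s) (ℕₚ.+-monoʳ-≤ (deg m) t≤s))

  *ₚ-monic-deg<-zero : ∀ m {h} → (toPoly m *ₚ h) deg< deg m → h ≋ []
  *ₚ-monic-deg<-zero m mh<m = deg<0⇒≋[] (*ₚ-monic-deg<⁻¹ m λ j le →
    mh<m j (ℕₚ.≤-trans (ℕₚ.m≤m+n (deg m) 0) le))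

  *ₚ-monic-cancelˡ : ∀ m {x y} → (toPoly m *ₚ x) ≋ (toPoly m *ₚ y) → x ≋ y
  *ₚ-monic-cancelˡ m {x} {y} mx≋my =
    ℙ.x∙y⁻¹≈ε⇒x≈y x y (*ₚ-monic-deg<-zero m (deg<-cong m[x-y]≋0 λ _ _ → refl))
    where
    open ≋-Reasoning
    m[x-y]≋0 : (toPoly m *ₚ (x +ₚ (-ₚ y))) ≋ []
    m[x-y]≋0 = begin
      toPoly m *ₚ (x +ₚ (-ₚ y))                        ≈⟨ ℙ.x[y-z]≈xy-xz (toPoly m) x y ⟩
      (toPoly m *ₚ x) +ₚ (-ₚ (toPoly m *ₚ y))          ≈⟨ +ₚ-cong mx≋my ≋-refl ⟩
      (toPoly m *ₚ y) +ₚ (-ₚ (toPoly m *ₚ y))          ≈⟨ -ₚ-inverseʳ (toPoly m *ₚ y) ⟩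
      []                                               ∎

  toPoly-deg< : ∀ m → toPoly m deg< suc (deg m)
  toPoly-deg< (monic d low) = toList++-deg< low 1#

  coeff-toPoly-deg : ∀ m → coeff (toPoly m) (deg m) ≡ 1#
  coeff-toPoly-deg (monic d low) = coeff-toList++-last low 1#

  -- Division with remainder, one coefficient at a time: if P = m·q + r then
  -- a + x·P = m·(x·q) + (a + x·r), and a + x·r, of degree ≤ deg m, is reduced
  -- by subtracting its x^(deg m) coefficient times m.
  rem : Monic → Poly → Poly
  rem m []      = []
  rem m (a ∷ P) = (a ∷ rem m P) +ₚ (-ₚ (coeff (a ∷ rem m P) (deg m) ·ₚ toPoly m))

  quot : Monic → Poly → Poly
  quot m []      = []
  quot m (a ∷ P) = (0# ∷ quot m P) +ₚ [ coeff (a ∷ rem m P) (deg m) ]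

  quot-rem : ∀ m P → P ≋ ((toPoly m *ₚ quot m P) +ₚ rem m P)
  quot-rem m []      = ≋-sym (≋-trans (+ₚ-identityʳ _) (*ₚ-zeroʳ (toPoly m)))
  quot-rem m (a ∷ P) = ≋-sym (begin
    (pm *ₚ ((0# ∷ q) +ₚ [ c ])) +ₚ (s +ₚ (-ₚ (c ·ₚ pm)))
      ≈⟨ +ₚ-cong (*ₚ-distribˡ-+ₚ pm (0# ∷ q) [ c ]) ≋-refl ⟩
    ((pm *ₚ (0# ∷ q)) +ₚ (pm *ₚ [ c ])) +ₚ (s +ₚ (-ₚ (c ·ₚ pm)))
      ≈⟨ +ₚ-cong (+ₚ-cong (*ₚ-0∷ pm q) (≋-trans (*ₚ-comm pm [ c ]) ([ c ]-*ₚ pm))) ≋-refl ⟩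
    ((0# ∷ (pm *ₚ q)) +ₚ (c ·ₚ pm)) +ₚ (s +ₚ (-ₚ (c ·ₚ pm)))
      ≈⟨ +ₚ.interchange (0# ∷ (pm *ₚ q)) (c ·ₚ pm) s _ ⟩
    ((0# ∷ (pm *ₚ q)) +ₚ s) +ₚ ((c ·ₚ pm) +ₚ (-ₚ (c ·ₚ pm)))
      ≈⟨ +ₚ-cong {p = (0# ∷ (pm *ₚ q)) +ₚ s} ≋-refl (-ₚ-inverseʳ (c ·ₚ pm)) ⟩
    ((0# ∷ (pm *ₚ q)) +ₚ s) +ₚ []
      ≈⟨ +ₚ-identityʳ ((0# ∷ (pm *ₚ q)) +ₚ s) ⟩
    (0# ∷ (pm *ₚ q)) +ₚ (a ∷ rem m P)
      ≈⟨ ∷-cong (𝔽.+-identityˡ a) (≋-sym (quot-rem m P)) ⟩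
    a ∷ P ∎)
    where
    open ≋-Reasoning
    pm = toPoly m
    q  = quot m P
    s  = a ∷ rem m P
    c  = coeff s (deg m)

  rem-deg< : ∀ m P → rem m P deg< deg m
  rem-deg< m []      j _   = refl
  rem-deg< m (a ∷ P) j m≤j = begin
    coeff (s +ₚ (-ₚ (c ·ₚ pm))) j
      ≡⟨ coeff-+ₚ s (-ₚ (c ·ₚ pm)) j ⟩
    coeff s j +ᶠ coeff (-ₚ (c ·ₚ pm)) j
      ≡⟨ cong (coeff s j +ᶠ_) (trans (coeff--ₚ (c ·ₚ pm) j) (cong -ᶠ_ (coeff-·ₚ c pm j))) ⟩
    coeff s j +ᶠ -ᶠ (c *ᶠ coeff pm j)
      ≡⟨ top-or-above (ℕₚ.m≤n⇒m<n∨m≡n m≤j) ⟩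
    0# ∎
    where
    open ≡-Reasoning
    pm = toPoly m
    s  = a ∷ rem m P
    c  = coeff s (deg m)
    top-or-above : deg m < j ⊎ deg m ≡ j → coeff s j +ᶠ -ᶠ (c *ᶠ coeff pm j) ≡ 0#
    top-or-above (inj₂ refl) = begin
      c +ᶠ -ᶠ (c *ᶠ coeff pm (deg m))   ≡⟨ cong (λ z → c +ᶠ -ᶠ (c *ᶠ z)) (coeff-toPoly-deg m) ⟩
      c +ᶠ -ᶠ (c *ᶠ 1#)                 ≡⟨ cong (λ z → c +ᶠ -ᶠ z) (𝔽.*-identityʳ c) ⟩
      c +ᶠ -ᶠ c                         ≡⟨ 𝔽.-‿inverseʳ c ⟩
      0#                                ∎
    top-or-above (inj₁ m<j) = above j m<j
      where
      above : ∀ j → deg m < j → coeff s j +ᶠ -ᶠ (c *ᶠ coeff pm j) ≡ 0#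
      above (suc j′) (s≤s m≤j′) = begin
        coeff (rem m P) j′ +ᶠ -ᶠ (c *ᶠ coeff pm (suc j′))
          ≡⟨ cong₂ (λ x y → x +ᶠ -ᶠ (c *ᶠ y))
                   (rem-deg< m P j′ m≤j′) (toPoly-deg< m (suc j′) (s≤s m≤j′)) ⟩
        0# +ᶠ -ᶠ (c *ᶠ 0#)
          ≡⟨ cong (λ z → 0# +ᶠ -ᶠ z) (𝔽.zeroʳ c) ⟩
        0# +ᶠ -ᶠ 0#
          ≡⟨ 𝔽.-‿inverseʳ 0# ⟩
        0# ∎

  quot-exact : ∀ m {h P} → (toPoly m *ₚ h) ≋ P → quot m P ≋ h
  quot-exact m {h} {P} mh≋P =
    ≋-sym (ℙ.x∙y⁻¹≈ε⇒x≈y h q (*ₚ-monic-deg<-zero m (deg<-cong m[h-q]≋r (rem-deg< m P))))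
    where
    open ≋-Reasoning
    pm = toPoly m
    q  = quot m P
    m[h-q]≋r : (pm *ₚ (h +ₚ (-ₚ q))) ≋ rem m P
    m[h-q]≋r = begin
      pm *ₚ (h +ₚ (-ₚ q))                              ≈⟨ ℙ.x[y-z]≈xy-xz pm h q ⟩
      (pm *ₚ h) +ₚ (-ₚ (pm *ₚ q))                      ≈⟨ +ₚ-cong (≋-trans mh≋P (quot-rem m P)) ≋-refl ⟩
      ((pm *ₚ q) +ₚ rem m P) +ₚ (-ₚ (pm *ₚ q))         ≈⟨ ℙ.xyx⁻¹≈y (pm *ₚ q) (rem m P) ⟩
      rem m P                                          ∎

  monic-∣⇒deg≤ : ∀ m m̃ M → toPoly M ≈ₚ (toPoly m *ₚ toPoly m̃) → deg m ≤ deg M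
  monic-∣⇒deg≤ m m̃ M M≈mm̃ = ℕₚ.m+n≤o⇒m≤o (deg m) (ℕₚ.≮⇒≥ M≮m+m̃)
    where
    open ≡-Reasoning
    M≮m+m̃ : ¬ (deg M < deg m + deg m̃)
    M≮m+m̃ M<m+m̃ = 0≢1 (begin
      0#                                               ≡⟨ toPoly-deg< M _ M<m+m̃ ⟨
      coeff (toPoly M) (deg m + deg m̃)                 ≡⟨ M≈mm̃ _ ⟩
      coeff (toPoly m *ₚ toPoly m̃) (deg m + deg m̃)     ≡⟨ *ₚ-monic-coeff m (toPoly-deg< m̃) ⟩
      coeff (toPoly m̃) (deg m̃)                         ≡⟨ coeff-toPoly-deg m̃ ⟩
      1#                                               ∎)

  degT-≥ : ∀ {r} a (v : Vec Monic r) → (∀ i → a ≤ deg (lookup v i)) → r * a ≤ degT v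
  degT-≥ a []      _  = z≤n
  degT-≥ a (p ∷ v) a≤ = ℕₚ.+-mono-≤ (a≤ Fin.zero) (degT-≥ a v (λ i → a≤ (Fin.suc i)))

module PolynomialMatrix (F : FiniteField) where
  open FiniteField F using (1#)
  open FF F
  open Polynomial F
  open import Algebra.Properties.Semiring.Sum (CommutativeRing.semiring polynomialRing)
    using (sum; sum-cong-≋; sum-replicate-zero; ∑-comm; *-distribˡ-sum; *-distribʳ-sum)

  private
    module *ₚ = CommutativeSemigroupProperties (CommutativeRing.*-commutativeSemigroup polynomialRing)

  infix 4 _≋ₘ_
  _≋ₘ_ : ∀ {m l} → PMat m l → PMat m l → Set
  A ≋ₘ B = ∀ i j → A i j ≋ B i j

  ≋ₘ-refl : ∀ {m l} {A : PMat m l} → A ≋ₘ A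
  ≋ₘ-refl i j = ≋-refl

  ≋ₘ-sym : ∀ {m l} {A B : PMat m l} → A ≋ₘ B → B ≋ₘ A
  ≋ₘ-sym A≋B i j = ≋-sym (A≋B i j)

  ≋ₘ-trans : ∀ {m l} {A B C : PMat m l} → A ≋ₘ B → B ≋ₘ C → A ≋ₘ C
  ≋ₘ-trans A≋B B≋C i j = ≋-trans (A≋B i j) (B≋C i j)

  ≋ₘ-setoid : ℕ → ℕ → Setoid 0ℓ 0ℓ
  ≋ₘ-setoid m l = record
    { Carrier = PMat m l ; _≈_ = _≋ₘ_
    ; isEquivalence = record { refl = ≋ₘ-refl ; sym = ≋ₘ-sym ; trans = ≋ₘ-trans } }

  module ≋ₘ-Reasoning {m l : ℕ} = Relation.Binary.Reasoning.Setoid (≋ₘ-setoid m l)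

  ≋ₘ⇒≈ₘ : ∀ {m l} {A B : PMat m l} → A ≋ₘ B → A ≈ₘ B
  ≋ₘ⇒≈ₘ A≋B i j = coeff-≡ (A≋B i j)

  ≈ₘ⇒≋ₘ : ∀ {m l} {A B : PMat m l} → A ≈ₘ B → A ≋ₘ B
  ≈ₘ⇒≋ₘ A≈B i j = coeffwise (A≈B i j)

  sumFin≡sum : ∀ {m} (f : Fin m → Poly) → sumFin f ≡ sum f
  sumFin≡sum {zero}  f = refl
  sumFin≡sum {suc m} f = cong (f Fin.zero +ₚ_) (sumFin≡sum (λ t → f (Fin.suc t)))

  mul≋sum : ∀ {m l r} (A : PMat m l) (B : PMat l r) i j → mul A B i j ≋ sum (λ t → A i t *ₚ B t j)
  mul≋sum A B i j = ≋-reflexive (sumFin≡sum (λ t → A i t *ₚ B t j))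

  mul-cong : ∀ {m l r} {A A′ : PMat m l} {B B′ : PMat l r} → A ≋ₘ A′ → B ≋ₘ B′ → mul A B ≋ₘ mul A′ B′
  mul-cong {A = A} {A′} {B} {B′} A≋A′ B≋B′ i j = begin
    mul A B i j                          ≈⟨ mul≋sum A B i j ⟩
    sum (λ t → A i t *ₚ B t j)           ≈⟨ sum-cong-≋ (λ t → *ₚ-cong (A≋A′ i t) (B≋B′ t j)) ⟩
    sum (λ t → A′ i t *ₚ B′ t j)         ≈⟨ mul≋sum A′ B′ i j ⟨
    mul A′ B′ i j                        ∎
    where open ≋-Reasoning

  mul-congˡ : ∀ {m l r} (A : PMat m l) {B B′ : PMat l r} → B ≋ₘ B′ → mul A B ≋ₘ mul A B′
  mul-congˡ A = mul-cong (≋ₘ-refl {A = A})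

  mul-congʳ : ∀ {m l r} (B : PMat l r) {A A′ : PMat m l} → A ≋ₘ A′ → mul A B ≋ₘ mul A′ B
  mul-congʳ B A≋A′ = mul-cong A≋A′ (≋ₘ-refl {A = B})

  mul-assoc : ∀ {m l r s} (A : PMat m l) (B : PMat l r) (C : PMat r s) →
              mul (mul A B) C ≋ₘ mul A (mul B C)
  mul-assoc A B C i j = begin
    mul (mul A B) C i j
      ≈⟨ mul≋sum (mul A B) C i j ⟩
    sum (λ t → mul A B i t *ₚ C t j)
      ≈⟨ sum-cong-≋ (λ t → *ₚ-congˡ (C t j) (mul≋sum A B i t)) ⟩
    sum (λ t → sum (λ u → A i u *ₚ B u t) *ₚ C t j)
      ≈⟨ sum-cong-≋ (λ t → *-distribʳ-sum (C t j) (λ u → A i u *ₚ B u t)) ⟩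
    sum (λ t → sum (λ u → (A i u *ₚ B u t) *ₚ C t j))
      ≈⟨ ∑-comm (λ t u → (A i u *ₚ B u t) *ₚ C t j) ⟩
    sum (λ u → sum (λ t → (A i u *ₚ B u t) *ₚ C t j))
      ≈⟨ sum-cong-≋ (λ u → sum-cong-≋ (λ t → *ₚ-assoc (A i u) (B u t) (C t j))) ⟩
    sum (λ u → sum (λ t → A i u *ₚ (B u t *ₚ C t j)))
      ≈⟨ sum-cong-≋ (λ u → *-distribˡ-sum (A i u) (λ t → B u t *ₚ C t j)) ⟨
    sum (λ u → A i u *ₚ sum (λ t → B u t *ₚ C t j))
      ≈⟨ sum-cong-≋ (λ u → *ₚ-congʳ (A i u) (mul≋sum B C u j)) ⟨
    sum (λ u → A i u *ₚ mul B C u j)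
      ≈⟨ mul≋sum A (mul B C) i j ⟨
    mul A (mul B C) i j
      ∎
    where open ≋-Reasoning

  diagWith-≡ : ∀ {m l} (f : Fin l → Poly) (i : Fin m) j → toℕ i ≡ toℕ j → diagWith f i j ≡ f j
  diagWith-≡ f i j i≡j with toℕ i ℕ.≟ toℕ j
  ... | yes _   = refl
  ... | no i≢j = contradiction i≡j i≢j

  diagWith-≢ : ∀ {m l} (f : Fin l → Poly) (i : Fin m) j → toℕ i ≢ toℕ j → diagWith f i j ≡ []
  diagWith-≢ f i j i≢j with toℕ i ℕ.≟ toℕ j
  ... | yes i≡j = contradiction i≡j i≢j
  ... | no _    = refl

  diagWith-suc : ∀ {m l} (f : Fin (suc l) → Poly) (i : Fin m) j →
                 diagWith f (Fin.suc i) (Fin.suc j) ≡ diagWith (λ t → f (Fin.suc t)) i j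
  diagWith-suc f i j with toℕ i ℕ.≟ toℕ j
  ... | yes i≡j = diagWith-≡ f (Fin.suc i) (Fin.suc j) (cong suc i≡j)
  ... | no i≢j  = diagWith-≢ f (Fin.suc i) (Fin.suc j) (λ e → i≢j (ℕₚ.suc-injective e))

  sum-Id-*ₚ : ∀ {m} (i : Fin m) (h : Fin m → Poly) → sum (λ t → Id i t *ₚ h t) ≋ h i
  sum-Id-*ₚ {suc m} Fin.zero    h = ≋-trans (+ₚ-cong (*ₚ-identityˡ (h Fin.zero)) (sum-replicate-zero m))
                                             (+ₚ-identityʳ (h Fin.zero))
  sum-Id-*ₚ {suc m} (Fin.suc i) h = ≋-trans
    (sum-cong-≋ (λ t → ≋-reflexive (cong (_*ₚ h (Fin.suc t)) (diagWith-suc _ i t))))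
    (sum-Id-*ₚ i (λ t → h (Fin.suc t)))

  sum-*ₚ-Id : ∀ {m} (j : Fin m) (h : Fin m → Poly) → sum (λ t → h t *ₚ Id t j) ≋ h j
  sum-*ₚ-Id {suc m} Fin.zero    h = ≋-trans
    (+ₚ-cong (*ₚ-identityʳ (h Fin.zero))
             (≋-trans (sum-cong-≋ (λ t → *ₚ-zeroʳ (h (Fin.suc t)))) (sum-replicate-zero m)))
    (+ₚ-identityʳ (h Fin.zero))
  sum-*ₚ-Id {suc m} (Fin.suc j) h = ≋-trans
    (+ₚ-cong (*ₚ-zeroʳ (h Fin.zero))
             (sum-cong-≋ (λ t → ≋-reflexive (cong (h (Fin.suc t) *ₚ_) (diagWith-suc _ t j)))))
    (sum-*ₚ-Id j (λ t → h (Fin.suc t)))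

  mul-identityˡ : ∀ {m l} (P : PMat m l) → mul Id P ≋ₘ P
  mul-identityˡ P i j = ≋-trans (mul≋sum Id P i j) (sum-Id-*ₚ i (λ t → P t j))

  mul-identityʳ : ∀ {m l} (P : PMat m l) → mul P Id ≋ₘ P
  mul-identityʳ P i j = ≋-trans (mul≋sum P Id i j) (sum-*ₚ-Id j (P i))

  scalₘ : ∀ {m l} → Poly → PMat m l → PMat m l
  scalₘ p A i j = p *ₚ A i j

  scalₘ-cong : ∀ {m l} p {A B : PMat m l} → A ≋ₘ B → scalₘ p A ≋ₘ scalₘ p B
  scalₘ-cong p A≋B i j = *ₚ-congʳ p (A≋B i j)

  diagWith-scalₘ : ∀ {m l} {f g : Fin l → Poly} p → (∀ j → f j ≋ (p *ₚ g j)) →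
                   diagWith {m} f ≋ₘ scalₘ p (diagWith g)
  diagWith-scalₘ p f≋pg i j with toℕ i ℕ.≟ toℕ j
  ... | yes _ = f≋pg j
  ... | no  _ = ≋-sym (*ₚ-zeroʳ p)

  mul-scalₘˡ : ∀ {m l r} p (A : PMat m l) (B : PMat l r) → mul (scalₘ p A) B ≋ₘ scalₘ p (mul A B)
  mul-scalₘˡ p A B i j = begin
    mul (scalₘ p A) B i j                  ≈⟨ mul≋sum (scalₘ p A) B i j ⟩
    sum (λ t → (p *ₚ A i t) *ₚ B t j)      ≈⟨ sum-cong-≋ (λ t → *ₚ-assoc p (A i t) (B t j)) ⟩
    sum (λ t → p *ₚ (A i t *ₚ B t j))      ≈⟨ *-distribˡ-sum p (λ t → A i t *ₚ B t j) ⟨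
    p *ₚ sum (λ t → A i t *ₚ B t j)        ≈⟨ *ₚ-congʳ p (mul≋sum A B i j) ⟨
    p *ₚ mul A B i j                       ∎
    where open ≋-Reasoning

  mul-scalₘʳ : ∀ {m l r} p (A : PMat m l) (B : PMat l r) → mul A (scalₘ p B) ≋ₘ scalₘ p (mul A B)
  mul-scalₘʳ p A B i j = begin
    mul A (scalₘ p B) i j                  ≈⟨ mul≋sum A (scalₘ p B) i j ⟩
    sum (λ t → A i t *ₚ (p *ₚ B t j))      ≈⟨ sum-cong-≋ (λ t → *ₚ.x∙yz≈y∙xz (A i t) p (B t j)) ⟩
    sum (λ t → p *ₚ (A i t *ₚ B t j))      ≈⟨ *-distribˡ-sum p (λ t → A i t *ₚ B t j) ⟨
    p *ₚ sum (λ t → A i t *ₚ B t j)        ≈⟨ *ₚ-congʳ p (mul≋sum A B i j) ⟨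
    p *ₚ mul A B i j                       ∎
    where open ≋-Reasoning

  mul-mul-scalₘ : ∀ {m l r s} p (A : PMat m l) (P : PMat l r) (B : PMat r s) →
                  mul (mul A (scalₘ p P)) B ≋ₘ scalₘ p (mul (mul A P) B)
  mul-mul-scalₘ p A P B = begin
    mul (mul A (scalₘ p P)) B     ≈⟨ mul-congʳ B (mul-scalₘʳ p A P) ⟩
    mul (scalₘ p (mul A P)) B     ≈⟨ mul-scalₘˡ p (mul A P) B ⟩
    scalₘ p (mul (mul A P) B)     ∎
    where open ≋ₘ-Reasoning

  mul-sandwich-cancel : ∀ {m l} (A′ A : PMat m m) (P : PMat m l) (B B′ : PMat l l) →
                        mul A′ A ≋ₘ Id → mul B B′ ≋ₘ Id → mul (mul A′ (mul (mul A P) B)) B′ ≋ₘ P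
  mul-sandwich-cancel A′ A P B B′ A′A≋I BB′≋I = begin
    mul (mul A′ (mul (mul A P) B)) B′   ≈⟨ mul-congʳ B′ (mul-assoc A′ (mul A P) B) ⟨
    mul (mul (mul A′ (mul A P)) B) B′   ≈⟨ mul-assoc (mul A′ (mul A P)) B B′ ⟩
    mul (mul A′ (mul A P)) (mul B B′)   ≈⟨ mul-cong (≋ₘ-sym (mul-assoc A′ A P)) BB′≋I ⟩
    mul (mul (mul A′ A) P) Id           ≈⟨ mul-identityʳ (mul (mul A′ A) P) ⟩
    mul (mul A′ A) P                    ≈⟨ mul-congʳ P A′A≋I ⟩
    mul Id P                            ≈⟨ mul-identityˡ P ⟩
    P                                   ∎
    where open ≋ₘ-Reasoning

  Equivalent-congˡ : ∀ {n k} {P P′ Q : PMat n k} → P ≋ₘ P′ → Equivalent P Q → Equivalent P′ Q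
  Equivalent-congˡ {P = P} {P′} {Q} P≋P′ (A , B , A-inv , B-inv , APB≈Q) =
    A , B , A-inv , B-inv , ≋ₘ⇒≈ₘ (begin
      mul (mul A P′) B   ≈⟨ mul-congʳ B (mul-congˡ A P≋P′) ⟨
      mul (mul A P) B    ≈⟨ ≈ₘ⇒≋ₘ APB≈Q ⟩
      Q                  ∎)
    where open ≋ₘ-Reasoning

  Equivalent-congʳ : ∀ {n k} {P Q Q′ : PMat n k} → Q ≋ₘ Q′ → Equivalent P Q → Equivalent P Q′
  Equivalent-congʳ Q≋Q′ (A , B , A-inv , B-inv , APB≈Q) =
    A , B , A-inv , B-inv , λ i j u → trans (APB≈Q i j u) (coeff-≡ (Q≋Q′ i j) u)

  Equivalent-scalₘ : ∀ {n k} p {P Q : PMat n k} → Equivalent P Q → Equivalent (scalₘ p P) (scalₘ p Q)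
  Equivalent-scalₘ p {P} (A , B , A-inv , B-inv , APB≈Q) =
    A , B , A-inv , B-inv , ≋ₘ⇒≈ₘ (λ i j →
      ≋-trans (mul-mul-scalₘ p A P B i j) (*ₚ-congʳ p (coeffwise (APB≈Q i j))))

  Equivalent-scalₘ⁻¹ : ∀ {n k} p {P Q : PMat n k} → (∀ {x y} → (p *ₚ x) ≋ (p *ₚ y) → x ≋ y) →
                       Equivalent (scalₘ p P) (scalₘ p Q) → Equivalent P Q
  Equivalent-scalₘ⁻¹ p {P} p-cancel (A , B , A-inv , B-inv , ApPB≈pQ) =
    A , B , A-inv , B-inv , ≋ₘ⇒≈ₘ (λ i j →
      p-cancel (≋-trans (≋-sym (mul-mul-scalₘ p A P B i j)) (coeffwise (ApPB≈pQ i j))))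

  infix 4 _∣ₘ_
  _∣ₘ_ : ∀ {m l} → Poly → PMat m l → Set
  p ∣ₘ P = Σ (PMat _ _) λ R → P ≋ₘ scalₘ p R

  Equivalent-scalₘ⇒∣ₘ : ∀ {n k} p {P D : PMat n k} → Equivalent P (scalₘ p D) → p ∣ₘ P
  Equivalent-scalₘ⇒∣ₘ p {P} {D} (A , B , (A′ , _ , A′A≈I) , (B′ , BB′≈I , _) , APB≈pD) =
    mul (mul A′ D) B′ , (begin
      P                                    ≈⟨ mul-sandwich-cancel A′ A P B B′ (≈ₘ⇒≋ₘ A′A≈I) (≈ₘ⇒≋ₘ BB′≈I) ⟨
      mul (mul A′ (mul (mul A P) B)) B′    ≈⟨ mul-congʳ B′ (mul-congˡ A′ (≈ₘ⇒≋ₘ APB≈pD)) ⟩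
      mul (mul A′ (scalₘ p D)) B′          ≈⟨ mul-mul-scalₘ p A′ D B′ ⟩
      scalₘ p (mul (mul A′ D) B′)          ∎)
    where open ≋ₘ-Reasoning

module CoefficientMatrix (F : FiniteField) (n k : ℕ) where
  open FiniteField F using (Carrier; 0#; 1#)
  open FF F
  open Monic
  open Polynomial F
  open MonicPolynomial F
  open PolynomialMatrix F

  δ : Fin n → Fin k → Carrier
  δ i j with toℕ i ℕ.≟ toℕ j
  ... | yes _ = 1#
  ... | no  _ = 0#

  -- Q is, up to ≋ₘ, an element x^d I + x^(d-1) C_(d-1) + ⋯ + C_0 of M_q(n,k,d).
  record InM (d : ℕ) (Q : PMat n k) : Set where
    field
      leading : ∀ i j → coeff (Q i j) d ≡ δ i j
      bounded : ∀ i j → Q i j deg< suc d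

  InM-cong : ∀ {d P Q} → P ≋ₘ Q → InM d P → InM d Q
  InM-cong P≋Q P∈M = record
    { leading = λ i j → trans (sym (coeff-≡ (P≋Q i j) _)) (InM.leading P∈M i j)
    ; bounded = λ i j → deg<-cong (≋-sym (P≋Q i j)) (InM.bounded P∈M i j) }

  InM-scalₘ : ∀ m {e Q} → InM e Q → InM (deg m + e) (scalₘ (toPoly m) Q)
  InM-scalₘ m {e} {Q} Q∈M = record
    { leading = λ i j → trans (*ₚ-monic-coeff m (InM.bounded Q∈M i j)) (InM.leading Q∈M i j)
    ; bounded = λ i j → subst (toPoly m *ₚ Q i j deg<_) (ℕₚ.+-suc (deg m) e)
                                (*ₚ-monic-deg< m {Q i j} (InM.bounded Q∈M i j)) }

  InM-scalₘ⁻¹ : ∀ m {e Q} → InM (deg m + e) (scalₘ (toPoly m) Q) → InM e Q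
  InM-scalₘ⁻¹ m {e} {Q} mQ∈M = record
    { leading = λ i j → trans (sym (*ₚ-monic-coeff m (bounded i j))) (InM.leading mQ∈M i j)
    ; bounded = bounded }
    where
    bounded : ∀ i j → Q i j deg< suc e
    bounded i j = *ₚ-monic-deg<⁻¹ m {Q i j}
      (subst (toPoly m *ₚ Q i j deg<_) (sym (ℕₚ.+-suc (deg m) e)) (InM.bounded mQ∈M i j))

  entry : ∀ {d} → Vec (CMat n k) d → Fin d → Fin n → Fin k → Carrier
  entry Cs t i j = lookup (lookup (lookup Cs t) i) j

  column : ∀ {d} → Vec (CMat n k) d → Fin n → Fin k → Vec Carrier d
  column Cs i j = Vec.map (λ C → lookup (lookup C i) j) Cs

  coeff-toPMat : ∀ {d} (Cs : Vec (CMat n k) d) i j t → coeff (toPMat Cs i j) (toℕ t) ≡ entry Cs t i j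
  coeff-toPMat Cs i j t = trans (coeff-toList++-lookup (column Cs i j) _ t)
                                (Vecₚ.lookup-map t (λ C → lookup (lookup C i) j) Cs)

  toPMat-InM : ∀ {d} (Cs : Vec (CMat n k) d) → InM d (toPMat Cs)
  toPMat-InM Cs = record { leading = leading ; bounded = λ i j → toList++-deg< (column Cs i j) _ }
    where
    leading : ∀ i j → coeff (toPMat Cs i j) _ ≡ δ i j
    leading i j with toℕ i ℕ.≟ toℕ j
    ... | yes _ = coeff-toList++-last (column Cs i j) 1#
    ... | no  _ = coeff-toList++-last (column Cs i j) 0#

  coefficients : ∀ d → PMat n k → Vec (CMat n k) d
  coefficients d Q = Vec.tabulate λ t → Vec.tabulate λ i → Vec.tabulate λ j → coeff (Q i j) (toℕ t)

  entry-coefficients : ∀ d Q t i j → entry (coefficients d Q) t i j ≡ coeff (Q i j) (toℕ t)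
  entry-coefficients d Q t i j = begin
    entry (coefficients d Q) t i j
      ≡⟨ cong (λ C → lookup (lookup C i) j) (Vecₚ.lookup∘tabulate _ t) ⟩
    lookup (lookup (Vec.tabulate λ i → Vec.tabulate λ j → coeff (Q i j) (toℕ t)) i) j
      ≡⟨ cong (λ r → lookup r j) (Vecₚ.lookup∘tabulate _ i) ⟩
    lookup (Vec.tabulate λ j → coeff (Q i j) (toℕ t)) j
      ≡⟨ Vecₚ.lookup∘tabulate _ j ⟩
    coeff (Q i j) (toℕ t) ∎
    where open ≡-Reasoning

  coefficients-toPMat : ∀ {d} (Cs : Vec (CMat n k) d) → coefficients d (toPMat Cs) ≡ Cs
  coefficients-toPMat Cs = trans (Vecₚ.tabulate-cong λ t → trans (Vecₚ.tabulate-cong λ i →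
      trans (Vecₚ.tabulate-cong λ j → coeff-toPMat Cs i j t) (Vecₚ.tabulate∘lookup _))
      (Vecₚ.tabulate∘lookup _)) (Vecₚ.tabulate∘lookup Cs)

  coefficients-cong : ∀ {d P Q} → P ≋ₘ Q → coefficients d P ≡ coefficients d Q
  coefficients-cong P≋Q = Vecₚ.tabulate-cong λ t → Vecₚ.tabulate-cong λ i →
    Vecₚ.tabulate-cong λ j → coeff-≡ (P≋Q i j) (toℕ t)

  toPMat-injective : ∀ {d} {Cs Cs′ : Vec (CMat n k) d} → toPMat Cs ≋ₘ toPMat Cs′ → Cs ≡ Cs′
  toPMat-injective {d} {Cs} {Cs′} Cs≋Cs′ = begin
    Cs                          ≡⟨ coefficients-toPMat Cs ⟨
    coefficients d (toPMat Cs)  ≡⟨ coefficients-cong Cs≋Cs′ ⟩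
    coefficients d (toPMat Cs′) ≡⟨ coefficients-toPMat Cs′ ⟩
    Cs′                         ∎
    where open ≡-Reasoning

  MSet-≡ : ∀ {d J} {C C′ : MSet n k d J} → MSet.coeffs C ≡ MSet.coeffs C′ → C ≡ C′
  MSet-≡ refl = refl

  toPMat-coefficients : ∀ {d Q} → InM d Q → toPMat (coefficients d Q) ≋ₘ Q
  toPMat-coefficients {d} {Q} Q∈M i j = coeffwise λ u → compare u (ℕₚ.<-cmp u d)
    where
    Cs = coefficients d Q
    compare : ∀ u → Tri (u < d) (u ≡ d) (d < u) → coeff (toPMat Cs i j) u ≡ coeff (Q i j) u
    compare u (tri< u<d _ _) =
      subst (λ v → coeff (toPMat Cs i j) v ≡ coeff (Q i j) v) (Finₚ.toℕ-fromℕ< u<d)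
            (trans (coeff-toPMat Cs i j t) (entry-coefficients d Q t i j))
      where t = Fin.fromℕ< u<d
    compare u (tri≈ _ refl _) =
      trans (InM.leading (toPMat-InM Cs) i j) (sym (InM.leading Q∈M i j))
    compare u (tri> _ _ d<u) =
      trans (InM.bounded (toPMat-InM Cs) i j u d<u) (sym (InM.bounded Q∈M i j u d<u))

module DivisionByContent (F : FiniteField) (n k : ℕ) (m : FF.Monic F) (e : ℕ) where
  open FiniteField F using (_≟_)
  open FF F
  open Monic
  open Polynomial F
  open MonicPolynomial F
  open PolynomialMatrix F
  open CoefficientMatrix F n k

  quotₘ : ∀ {r l} → PMat r l → PMat r l
  quotₘ P i j = quot m (P i j)

  quotₘ-exact : ∀ {r l} {P : PMat r l} → toPoly m ∣ₘ P → P ≋ₘ scalₘ (toPoly m) (quotₘ P)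
  quotₘ-exact (R , P≋mR) i j =
    ≋-trans (P≋mR i j) (*ₚ-congʳ (toPoly m) (≋-sym (quot-exact m (≋-sym (P≋mR i j)))))

  shrink : Vec (CMat n k) (deg m + e) → Vec (CMat n k) e
  shrink Cs = coefficients e (quotₘ (toPMat Cs))

  expand : Vec (CMat n k) e → Vec (CMat n k) (deg m + e)
  expand Qs = coefficients (deg m + e) (scalₘ (toPoly m) (toPMat Qs))

  toPMat-expand : ∀ Qs → toPMat (expand Qs) ≋ₘ scalₘ (toPoly m) (toPMat Qs)
  toPMat-expand Qs = toPMat-coefficients (InM-scalₘ m (toPMat-InM Qs))

  toPMat-shrink : ∀ Cs → toPoly m ∣ₘ toPMat Cs → scalₘ (toPoly m) (toPMat (shrink Cs)) ≋ₘ toPMat Cs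
  toPMat-shrink Cs m∣Cs = begin
    scalₘ (toPoly m) (toPMat (shrink Cs))   ≈⟨ scalₘ-cong (toPoly m) (toPMat-coefficients Q∈M) ⟩
    scalₘ (toPoly m) Q                      ≈⟨ ≋ₘ-sym P≋mQ ⟩
    toPMat Cs                               ∎
    where
    open ≋ₘ-Reasoning
    Q = quotₘ (toPMat Cs)
    P≋mQ : toPMat Cs ≋ₘ scalₘ (toPoly m) Q
    P≋mQ = quotₘ-exact m∣Cs
    Q∈M : InM e Q
    Q∈M = InM-scalₘ⁻¹ m (InM-cong P≋mQ (toPMat-InM Cs))

  shrink-expand : ∀ Qs → shrink (expand Qs) ≡ Qs
  shrink-expand Qs = toPMat-injective λ i j → *ₚ-monic-cancelˡ m (begin
    toPoly m *ₚ toPMat (shrink (expand Qs)) i j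
      ≈⟨ toPMat-shrink (expand Qs) (toPMat Qs , toPMat-expand Qs) i j ⟩
    toPMat (expand Qs) i j
      ≈⟨ toPMat-expand Qs i j ⟩
    toPoly m *ₚ toPMat Qs i j ∎)
    where open ≋-Reasoning

  expand-shrink : ∀ Cs → toPoly m ∣ₘ toPMat Cs → expand (shrink Cs) ≡ Cs
  expand-shrink Cs m∣Cs = toPMat-injective (begin
    toPMat (expand (shrink Cs))                   ≈⟨ toPMat-expand (shrink Cs) ⟩
    scalₘ (toPoly m) (toPMat (shrink Cs))         ≈⟨ toPMat-shrink Cs m∣Cs ⟩
    toPMat Cs                                     ∎)
    where open ≋ₘ-Reasoning

  shrink-Equivalent : ∀ Cs {D : PMat n k} → Equivalent (toPMat Cs) (scalₘ (toPoly m) D) →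
                      Equivalent (toPMat (shrink Cs)) D
  shrink-Equivalent Cs {D} Cs∼mD = Equivalent-scalₘ⁻¹ (toPoly m) (*ₚ-monic-cancelˡ m)
    (Equivalent-congˡ {Q = scalₘ (toPoly m) D} (≋ₘ-sym (toPMat-shrink Cs m∣Cs)) Cs∼mD)
    where
    m∣Cs : toPoly m ∣ₘ toPMat Cs
    m∣Cs = Equivalent-scalₘ⇒∣ₘ (toPoly m) Cs∼mD

  expand-Equivalent : ∀ Qs {D : PMat n k} → Equivalent (toPMat Qs) D →
                      Equivalent (toPMat (expand Qs)) (scalₘ (toPoly m) D)
  expand-Equivalent Qs {D} Qs∼D =
    Equivalent-congˡ {Q = scalₘ (toPoly m) D} (≋ₘ-sym (toPMat-expand Qs)) (Equivalent-scalₘ (toPoly m) Qs∼D)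

  _≟ᶜ_ : ∀ {d} → DecidableEquality (Vec (CMat n k) d)
  _≟ᶜ_ = Vecₚ.≡-dec (Vecₚ.≡-dec (Vecₚ.≡-dec _≟_))

  MSet-shrink : ∀ {I Ĩ} → diagₘ {n} I ≋ₘ scalₘ (toPoly m) (diagₘ Ĩ) →
                MSet n k (deg m + e) I ↔ MSet n k e Ĩ
  MSet-shrink {I} {Ĩ} I≋mĨ = mk↔ₛ′ to from to∘from from∘to
    where
    to : MSet n k (deg m + e) I → MSet n k e Ĩ
    to (mk Cs ∣ Cs∼I ∣) = mk (shrink Cs) ∣ shrink-Equivalent Cs (Equivalent-congʳ I≋mĨ Cs∼I) ∣
    from : MSet n k e Ĩ → MSet n k (deg m + e) I
    from (mk Qs ∣ Qs∼Ĩ ∣) =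
      mk (expand Qs) ∣ Equivalent-congʳ (≋ₘ-sym I≋mĨ) (expand-Equivalent Qs Qs∼Ĩ) ∣
    to∘from : ∀ Q → to (from Q) ≡ Q
    to∘from (mk Qs _) = MSet-≡ (shrink-expand Qs)
    -- The equivalence is irrelevant, so the equation it yields is recomputed by deciding it.
    from∘to : ∀ C → from (to C) ≡ C
    from∘to (mk Cs ∣ Cs∼I ∣) = MSet-≡ (recompute (expand (shrink Cs) ≟ᶜ Cs)
      (expand-shrink Cs (Equivalent-scalₘ⇒∣ₘ (toPoly m) (Equivalent-congʳ I≋mĨ Cs∼I))))

lemma3p5 : (F : FiniteField) (n k' d : ℕ) → suc k' ≤ n →
    (I : Vec (FF.Monic F) (suc k')) → FF.IsInvariantFactors F I →
    FF.degT F I ≤ suc k' * d →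
    (Ĩ : Vec (FF.Monic F) (suc k')) →
    (∀ (i : Fin (suc k')) → FF._≈ₚ_ F (FF.toPoly F (lookup I i))
        (FF._*ₚ_ F (FF.toPoly F (head I)) (FF.toPoly F (lookup Ĩ i)))) →
    FF.MSet F n (suc k') d I ↔ FF.MSet F n (suc k') (d ∸ FF.Monic.deg {F} (head I)) Ĩ
lemma3p5 F n k' d _ I _ degI≤kd Ĩ I≈p₁Ĩ =
  subst (λ d′ → MSet n (suc k') d′ I ↔ MSet n (suc k') (d ∸ d₁) Ĩ) (ℕₚ.m+[n∸m]≡n d₁≤d)
        (DivisionByContent.MSet-shrink F n (suc k') (head I) (d ∸ d₁)
          (diagWith-scalₘ (toPoly (head I)) (λ j → coeffwise (I≈p₁Ĩ j))))
  where
  open FF F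
  open Polynomial F using (coeffwise)
  open MonicPolynomial F using (degT-≥; monic-∣⇒deg≤)
  open PolynomialMatrix F using (diagWith-scalₘ)
  d₁ = Monic.deg (head I)
  k*d₁≤degI : suc k' * d₁ ≤ degT I
  k*d₁≤degI = degT-≥ d₁ I (λ i → monic-∣⇒deg≤ (head I) (lookup Ĩ i) (lookup I i) (I≈p₁Ĩ i))
  d₁≤d : d₁ ≤ d
  d₁≤d = ℕₚ.*-cancelˡ-≤ (suc k') (ℕₚ.≤-trans k*d₁≤degI degI≤kd)
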